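{- Let $\mathcal{N}$ be a MEMDP and $\mathcal{G}_{\mathcal{N}}$ its BOMDP. For every pair of paths $\pi,\pi'$ of $\mathcal{G}_{\mathcal{N}}$, if $O(\mathit{last}(\pi))=O(\mathit{last}(\pi'))$ then $\mathcal{B}(\pi)=\mathcal{B}(\pi')$.
   Context: An MDP is $\langle S,A,\iota,p\rangle$ with finite $S,A$, initial distribution $\iota$, total $p\colon S\times A\to\mathit{Dist}(S)$; a path is $x_0a_0x_1\dots x_n$ with $\iota(x_0)>0$ and $p(x_k,a_k)(x_{k+1})>0$; $\mathit{last}$ is its last state. A MEMDP $\mathcal{N}=\langle S,A,\iota,\{p_i\}_{i\in I}\rangle$ has finite environment set $I$ and transition functions $p_i$. For $J\subseteq I$ let $\mathsf{Up}(J,s,a,s')=\{i\in J:p_i(s,a)(s')>0\}$. The belief of a history $s_0a_0\dots s_n$ over $S$ is defined by $\mathcal{B}(s_0)=I$ and $\mathcal{B}(\rho\cdot s\,a\,s')=\mathsf{Up}(\mathcal{B}(\rho\cdot s),s,a,s')$; for a path of $\mathcal{G}_{\mathcal{N}}$, $\mathcal{B}$ is applied to its projection onto the first components of the states. The BOMDP $\mathcal{G}_{\mathcal{N}}$ has states $S\times I\times 2^I$, actions $A$, initial distribution $\iota'(\langle s,j,I\rangle)=\iota(s)/|I|$ (zero elsewhere), transitions $p'(\langle s,j,J\rangle,a)(\langle s',j,J'\rangle)=p_j(s,a)(s')$ if $J'=\mathsf{Up}(J,s,a,s')$ and $0$ otherwise, and observation function $O(\langle s,j,J\rangle)=\langle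 s,J\rangle$.
   Formalization: The initial distribution ι and the transition functions $p_i$ of the MEMDP take rational values. -}

module Defs where

open import Data.Nat as ℕ using (ℕ; zero; suc; NonZero)
open import Data.Integer using (+_)
open import Data.Rational using (ℚ; 0ℚ; 1ℚ; _+_; _*_; _/_; _<_; _≤_)
open import Data.Rational.Properties using (_<?_)
open import Data.Fin using (Fin; zero; suc)
open import Data.Fin.Subset using (Subset; ⊤)
open import Data.Vec using (Vec; lookup; tabulate)
open import Data.Vec.Properties using (≡-dec)
open import Data.Bool using (Bool; _∧_; true; false; if_then_else_)
import Data.Bool.Properties as BoolP
open import Data.Product using (_×_; _,_; proj₁; proj₂; Σ)
open import Relation.Nullary.Decidable using (⌊_⌋)
open import Relation.Binary.PropositionalEquality using (_≡_)

sumFin : ∀ {n} → (Fin n → ℚ) → ℚ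
sumFin {zero}  f = 0ℚ
sumFin {suc n} f = f zero + sumFin (λ i → f (suc i))

record Dist (n : ℕ) : Set where
  field
    prob   : Fin n → ℚ
    nonneg : ∀ x → 0ℚ ≤ prob x
    total  : sumFin prob ≡ 1ℚ
open Dist public

record MDP : Set₁ where
  field
    State  : Set
    Action : Set
    init   : State → ℚ
    trans  : State → Action → State → ℚ

module _ (M : MDP) where
  open MDP M

  data PathTo : State → Set where
    start : (x : State) → 0ℚ < init x → PathTo x
    step  : ∀ {x} → PathTo x → (a : Action) → (x' : State)
          → 0ℚ < trans x a x' → PathTo x'

  Path : Set
  Path = Σ State PathTo

  last : Path → State
  last = proj₁

record MEMDP : Set where
  field
    nS nA nI : ℕ
    -- the environment set I is nonempty (needed for ι(s)/|I|)
    {{I-nonempty}} : NonZero nI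
    ι  : Dist nS
    p  : Fin nI → Fin nS → Fin nA → Dist nS

module _ (N : MEMDP) where
  open MEMDP N

  S A : Set
  S = Fin nS
  A = Fin nA

  Up : Subset nI → S → A → S → Subset nI
  Up J s a s' = tabulate λ i → lookup J i ∧ ⌊ 0ℚ <? prob (p i s a) s' ⌋

  data Hist : Set where
    hstart : S → Hist
    hstep  : Hist → A → S → Hist

  hlast : Hist → S
  hlast (hstart s)     = s
  hlast (hstep ρ a s') = s'

  belief : Hist → Subset nI
  belief (hstart s)     = ⊤
  belief (hstep ρ a s') = Up (belief ρ) (hlast ρ) a s'

  GState : Set
  GState = S × Fin nI × Subset nI

  _≟S_ : (J J' : Subset nI) → Relation.Nullary.Decidable.Dec (J ≡ J')
  _≟S_ = ≡-dec BoolP._≟_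

  ι' : GState → ℚ
  ι' (s , j , J) =
    if ⌊ J ≟S ⊤ ⌋ then prob ι s * ((+ 1) / nI) else 0ℚ

  p' : GState → A → GState → ℚ
  p' (s , j , J) a (s' , j' , J') =
    if ⌊ j Data.Fin.≟ j' ⌋ ∧ ⌊ J' ≟S Up J s a s' ⌋
    then prob (p j s a) s' else 0ℚ

  G : MDP
  G = record { State = GState ; Action = A ; init = ι' ; trans = p' }

  O : GState → S × Subset nI
  O (s , j , J) = s , J

  projTo : ∀ {x} → PathTo G x → Hist
  projTo (start (s , _) _)       = hstart s
  projTo (step π a (s' , _) _)   = hstep (projTo π) a s'

  proj : Path G → Hist
  proj (_ , π) = projTo π

  beliefG : Path G → Subset nI
  beliefG π = belief (proj π)

-- Every state ⟨s, j, J⟩ reachable in the BOMDP carries in J exactly the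
-- belief of its projected history: the initial distribution is supported on
-- J = I, and a positive transition forces J' = Up(J, s, a, s'), which is the
-- recursion defining the belief.  The observation exposes J, so two paths
-- with the same last observation have the same belief.
module Submission where

open import Defs
open import Data.Bool using (Bool; T; true; false; if_then_else_)
open import Data.Bool.Properties using (T-∧)
open import Data.Fin using (_≟_)
open import Data.Product using (_,_; proj₁; proj₂)
open import Data.Rational using (ℚ; 0ℚ; _<_)
open import Data.Rational.Properties using (<-irrefl)
open import Function.Bundles using (Equivalence)
open import Relation.Nullary.Decidable using (⌊_⌋; toWitness)
open import Relation.Binary.PropositionalEquality using (_≡_; refl; sym; trans; cong; cong₂; module ≡-Reasoning)

positive-if⇒T : ∀ (b : Bool) {x : ℚ} → 0ℚ < (if b then x else 0ℚ) → T b
positive-if⇒T true  _   = _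
positive-if⇒T false 0<0 = <-irrefl refl 0<0

module _ (N : MEMDP) where

  init-positive⇒belief-hstart : ∀ {s j J} → 0ℚ < ι' N (s , j , J) → J ≡ belief N (hstart s)
  init-positive⇒belief-hstart {J = J} q = toWitness (positive-if⇒T (⌊ _≟S_ N J _ ⌋) q)

  trans-positive⇒Up : ∀ {s j J a s' j' J'} → 0ℚ < p' N (s , j , J) a (s' , j' , J')
                    → J' ≡ Up N J s a s'
  trans-positive⇒Up {j = j} {j' = j'} q =
    toWitness (proj₂ (Equivalence.to (T-∧ {⌊ j ≟ j' ⌋}) (positive-if⇒T _ q)))

  hlast-projTo : ∀ {x} (π : PathTo (G N) x) → hlast N (projTo N π) ≡ proj₁ x
  hlast-projTo (start _ _)    = refl
  hlast-projTo (step _ _ _ _) = refl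

  belief-projTo : ∀ {x} (π : PathTo (G N) x) → belief N (projTo N π) ≡ proj₂ (proj₂ x)
  belief-projTo (start (_ , j , _) q) = sym (init-positive⇒belief-hstart {j = j} q)
  belief-projTo (step {s , j , J} π a (s' , j' , J') q) = begin
    Up N (belief N (projTo N π)) (hlast N (projTo N π)) a s'
      ≡⟨ cong₂ (λ K t → Up N K t a s') (belief-projTo π) (hlast-projTo π) ⟩
    Up N J s a s'
      ≡⟨ sym (trans-positive⇒Up {j = j} {J = J} {j' = j'} q) ⟩
    J' ∎
    where open ≡-Reasoning

lemma3 : (N : MEMDP) (π π' : Path (G N))
       → O N (last (G N) π) ≡ O N (last (G N) π')
       → beliefG N π ≡ beliefG N π'
lemma3 N (_ , π) (_ , π') same-observation =
  trans (belief-projTo N π) (trans (cong proj₂ same-observation) (sym (belief-projTo N π')))
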